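{- Let $\mathfrak{h}=\mathfrak{n}\oplus\mathfrak{m}$ be a Hoffman graph with $\mathfrak{n}$ and $\mathfrak{m}$ non-empty. Then $\psi(x)=x$ for every $x\in V_f(\mathfrak{n})\cap V_f(\mathfrak{m})$ and every $\psi\in\mathrm{Aut}^*(\mathfrak{h})$.
   Context: A Hoffman graph $\mathfrak{h}=(H,\mu)$ is a finite simple graph $H$ with labeling $\mu:V(H)\to\{f,s\}$ such that every fat vertex (label $f$) has a slim neighbour (label $s$), and fat vertices are pairwise non-adjacent. $V_s,V_f$ denote slim/fat vertex sets, $N^f_{\mathfrak{h}}(x)$ fat neighbours of $x$. A Hoffman subgraph is an induced subgraph with restricted labeling; automorphisms are label-preserving graph automorphisms. $\mathrm{Aut}^*(\mathfrak{h})=\{\psi\in\mathrm{Aut}(\mathfrak{h}):\psi|_{V_s(\mathfrak{h})}=\mathrm{id}_{V_s(\mathfrak{h})}\}$. Sum: $\mathfrak{h}=\mathfrak{h}^1\oplus\mathfrak{h}^2$ for Hoffman subgraphs means (i) $V(\mathfrak{h})=V(\mathfrak{h}^1)\cup V(\mathfrak{h}^2)$; (ii) $V_s(\mathfrak{h})=V_s(\mathfrak{h}^1)\sqcup V_s(\mathfrak{h}^2)$; (iii) $N^f_{\mathfrak{h}^i}(x)=N^f_{\mathfrak{h}}(x)$ for $x\in V_s(\mathfrak{h}^i)$; (iv) for $x\in V_s(\mathfrak{h}^1)$, $y\in V_s(\mathfrak{h}^2)$: $|N^f_{\mathfrak{h}}(x)\cap N^f_{\mathfrak{h}}(y)|\le1$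 with equality iff $x,y$ adjacent. -}

module Defs where

open import Data.Nat using (ℕ; _≤_)
open import Data.Bool using (Bool; true; false; _∧_; _∨_; not)
open import Data.Fin using (Fin)
open import Data.List using (length; filterᵇ; allFin)
open import Data.Product using (Σ; _×_; ∃; ∃-syntax)
open import Data.Fin.Permutation using (Permutation′; _⟨$⟩ʳ_)
open import Relation.Binary.PropositionalEquality using (_≡_)
open import Function.Bundles using (_⇔_)
open import Data.Empty using (⊥)

data Label : Set where
  fat slim : Label

isFat : Label → Bool
isFat fat  = true
isFat slim = false

isSlim : Label → Bool
isSlim l = not (isFat l)

record HoffmanGraph : Set where
  field
    n     : ℕ
    adj   : Fin n → Fin n → Bool
    label : Fin n → Label
    adj-sym   : ∀ x y → adj x y ≡ adj y x
    adj-irrefl : ∀ x → adj x x ≡ false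
    fat-has-slim : ∀ x → label x ≡ fat → ∃[ y ] (label y ≡ slim × adj x y ≡ true)
    fat-indep : ∀ x y → label x ≡ fat → label y ≡ fat → adj x y ≡ false

module _ (h : HoffmanGraph) where
  open HoffmanGraph h

  VSubset : Set
  VSubset = Fin n → Bool

  -- x is a fat vertex of h lying in S (i.e. x ∈ V_f of the induced subgraph on S).
  FatIn : VSubset → Fin n → Set
  FatIn S x = S x ≡ true × label x ≡ fat

  SlimIn : VSubset → Fin n → Set
  SlimIn S x = S x ≡ true × label x ≡ slim

  -- The induced subgraph on S with restricted labelling is a Hoffman graph
  -- (symmetry, irreflexivity and independence of fat vertices are inherited;
  -- the remaining condition is that every fat vertex of S has a slim
  -- neighbour inside S).
  IsHoffmanSubgraph : VSubset → Set
  IsHoffmanSubgraph S = ∀ x → FatIn S x → ∃[ y ] (SlimIn S y × adj x y ≡ true)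

  NonEmpty : VSubset → Set
  NonEmpty S = ∃[ x ] (S x ≡ true)

  commonFat : Fin n → Fin n → ℕ
  commonFat x y =
    length (filterᵇ (λ z → isFat (label z) ∧ (adj x z ∧ adj y z)) (allFin n))

  record IsSum (S₁ S₂ : VSubset) : Set where
    field
      sub₁ : IsHoffmanSubgraph S₁
      sub₂ : IsHoffmanSubgraph S₂
      -- (i) V(h) = V(h¹) ∪ V(h²)
      cover : ∀ x → S₁ x ∨ S₂ x ≡ true
      -- (ii) V_s(h) = V_s(h¹) ⊔ V_s(h²)  (the union part follows from (i))
      slim-disjoint : ∀ x → label x ≡ slim → S₁ x ≡ true → S₂ x ≡ true → ⊥
      fatNbr₁ : ∀ x y → SlimIn S₁ x → label y ≡ fat → adj x y ≡ true → S₁ y ≡ true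
      fatNbr₂ : ∀ x y → SlimIn S₂ x → label y ≡ fat → adj x y ≡ true → S₂ y ≡ true
      -- (iv)
      common-le : ∀ x y → SlimIn S₁ x → SlimIn S₂ y → commonFat x y ≤ 1
      common-eq : ∀ x y → SlimIn S₁ x → SlimIn S₂ y → (commonFat x y ≡ 1 ⇔ adj x y ≡ true)

  IsAut : Permutation′ n → Set
  IsAut ψ = (∀ x y → adj (ψ ⟨$⟩ʳ x) (ψ ⟨$⟩ʳ y) ≡ adj x y)
          × (∀ x → label (ψ ⟨$⟩ʳ x) ≡ label x)

  IsAut* : Permutation′ n → Set
  IsAut* ψ = IsAut ψ × (∀ x → label x ≡ slim → ψ ⟨$⟩ʳ x ≡ x)

module Submission where

-- Let x be fat in both n and m.  Since n and m are Hoffman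
-- subgraphs, x has a slim neighbour y in n and a slim neighbour w in m, and
-- by axiom (iv) of the sum, y and w have at most one common fat neighbour.
-- An automorphism fixing the slim vertices y and w maps x to a vertex that
-- is again fat and adjacent to both y and w; so x and ψ x are common fat
-- neighbours of y and w, whence ψ x = x.

open import Defs
open import Data.Fin.Permutation using (Permutation′; _⟨$⟩ʳ_)
open import Relation.Binary.PropositionalEquality
  using (_≡_; _≢_; refl; sym; trans; cong; module ≡-Reasoning)
open import Data.Nat using (_≤_; z≤n; s≤s)
open import Data.Nat.Properties using (m≤n⇒m≤1+n; ≤-trans)
open import Data.Bool using (Bool; true; false; _∧_)
open import Data.List using (length; filterᵇ)
open import Data.List.Membership.Propositional using (_∈_)
open import Data.List.Membership.Propositional.Properties using (∈-allFin)
open import Data.List.Relation.Unary.Any using (here; there)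
open import Data.Fin using (Fin; _≟_)
open import Data.Product using (∃-syntax; _×_; _,_; proj₂)
open import Relation.Nullary using (yes; no; ¬_; contradiction)

module FilterCount {A : Set} (p : A → Bool) where

  filter-length-≥1 : ∀ {x xs} → p x ≡ true → x ∈ xs → 1 ≤ length (filterᵇ p xs)
  filter-length-≥1 px (here refl) rewrite px = s≤s z≤n
  filter-length-≥1 px (there {x = a} x∈xs) with p a
  ... | true  = s≤s z≤n
  ... | false = filter-length-≥1 px x∈xs

  filter-length-≥2 : ∀ {x x′ xs} → p x ≡ true → p x′ ≡ true → x ≢ x′ →
                     x ∈ xs → x′ ∈ xs → 2 ≤ length (filterᵇ p xs)
  filter-length-≥2 px px′ x≢x′ (here refl) (here refl) with () ← x≢x′ refl
  filter-length-≥2 px px′ x≢x′ (here refl) (there x′∈xs)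
    rewrite px = s≤s (filter-length-≥1 px′ x′∈xs)
  filter-length-≥2 px px′ x≢x′ (there x∈xs) (here refl)
    rewrite px′ = s≤s (filter-length-≥1 px x∈xs)
  filter-length-≥2 px px′ x≢x′ (there {x = a} x∈xs) (there x′∈xs) with p a
  ... | true  = m≤n⇒m≤1+n (filter-length-≥2 px px′ x≢x′ x∈xs x′∈xs)
  ... | false = filter-length-≥2 px px′ x≢x′ x∈xs x′∈xs

open FilterCount using (filter-length-≥2)

module _ (h : HoffmanGraph) where
  open HoffmanGraph h

  commonFat-≥2 : ∀ {y w x x′} → x ≢ x′ →
                 label x ≡ fat → adj y x ≡ true → adj w x ≡ true →
                 label x′ ≡ fat → adj y x′ ≡ true → adj w x′ ≡ true →
                 2 ≤ commonFat h y w
  commonFat-≥2 {y} {w} x≢x′ fx yx wx fx′ yx′ wx′ =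
    filter-length-≥2 isCommonFat (counts fx yx wx) (counts fx′ yx′ wx′) x≢x′
      (∈-allFin _) (∈-allFin _)
    where
    isCommonFat : Fin n → Bool
    isCommonFat z = isFat (label z) ∧ (adj y z ∧ adj w z)

    counts : ∀ {z} → label z ≡ fat → adj y z ≡ true → adj w z ≡ true →
             isCommonFat z ≡ true
    counts fz yz wz rewrite fz | yz | wz = refl

  aut-fix-preserves-adj : ∀ (ψ : Permutation′ n) → IsAut h ψ → ∀ {y x} →
                          ψ ⟨$⟩ʳ y ≡ y → adj y x ≡ true → adj y (ψ ⟨$⟩ʳ x) ≡ true
  aut-fix-preserves-adj ψ (ψ-adj , _) {y} {x} ψy≡y yx = begin
    adj y (ψ ⟨$⟩ʳ x)            ≡⟨ cong (λ u → adj u (ψ ⟨$⟩ʳ x)) (sym ψy≡y) ⟩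
    adj (ψ ⟨$⟩ʳ y) (ψ ⟨$⟩ʳ x)   ≡⟨ ψ-adj y x ⟩
    adj y x                     ≡⟨ yx ⟩
    true                        ∎
    where open ≡-Reasoning

  slim-neighbour : ∀ {S} → IsHoffmanSubgraph h S → ∀ {x} → FatIn h S x →
                   ∃[ y ] (SlimIn h S y × adj y x ≡ true)
  slim-neighbour sub {x} fx with sub x fx
  ... | y , yS , xy = y , yS , trans (adj-sym y x) xy

  -- The core rigidity fact: if slim vertices y and w have at most one common
  -- fat neighbour, every ψ ∈ Aut*(h) fixes each common fat neighbour x of
  -- them, since ψ x is again one and differs from x otherwise.
  aut*-fixes-unique-common-fat :
    ∀ (ψ : Permutation′ n) → IsAut* h ψ → ∀ {y w x} →
    label y ≡ slim → label w ≡ slim → commonFat h y w ≤ 1 →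
    label x ≡ fat → adj y x ≡ true → adj w x ≡ true → ψ ⟨$⟩ʳ x ≡ x
  aut*-fixes-unique-common-fat ψ (aut , fixSlim) {y} {w} {x} slimY slimW atMostOne fatX yx wx
    with ψ ⟨$⟩ʳ x ≟ x
  ... | yes ψx≡x = ψx≡x
  ... | no ψx≢x = contradiction (≤-trans twoCommon atMostOne) 2≰1
    where
    2≰1 : ¬ 2 ≤ 1
    2≰1 (s≤s ())

    twoCommon : 2 ≤ commonFat h y w
    twoCommon = commonFat-≥2 (λ x≡ψx → ψx≢x (sym x≡ψx)) fatX yx wx
      (trans (proj₂ aut x) fatX)
      (aut-fix-preserves-adj ψ aut (fixSlim y slimY) yx)
      (aut-fix-preserves-adj ψ aut (fixSlim w slimW) wx)

-- Main theorem (Lemma 5.5): Aut*(n ⊕ m) fixes every common fat vertex x.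
-- x has slim neighbours y ∈ n and w ∈ m, and axiom (iv) of the sum bounds
-- their common fat neighbours by one.
lemma5p5 : (h : HoffmanGraph) (N M : VSubset h) →
    IsSum h N M → NonEmpty h N → NonEmpty h M →
    (ψ : Permutation′ (HoffmanGraph.n h)) → IsAut* h ψ →
    ∀ x → FatIn h N x → FatIn h M x → ψ ⟨$⟩ʳ x ≡ x
lemma5p5 h N M sum _ _ ψ ψ∈Aut* x fatN fatM
  with y , slimY , yx ← slim-neighbour h (IsSum.sub₁ sum) fatN
     | w , slimW , wx ← slim-neighbour h (IsSum.sub₂ sum) fatM
  = aut*-fixes-unique-common-fat h ψ ψ∈Aut* (proj₂ slimY) (proj₂ slimW)
      (IsSum.common-le sum y w slimY slimW) (proj₂ fatN) yx wx
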